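{- Let $Q$ be a quiver consisting of a single zigzag, i.e. the underlying graph of $Q$ is a path with at least three vertices and the arrows alternate in direction along the path, so that every vertex is either a source or a sink. Fix any ordering of the sources of $Q$ and any ordering of the sinks of $Q$, and let $\mu_{z_c}$ (resp. $\mu_{z_k}$) be the sequence of mutations at all sources (resp. all sinks) in that order. Then $\mu_{z_k}\mu_{z_c}$ (first mutate at all sources, then at all sinks) is a maximal green sequence for $Q$ of minimal length.
   Context: Mutation $\mu_k$ of a quiver (without loops and oriented 2-cycles) at a vertex $k$: for every path $h \to k \to l$ add an arrow $h \to l$; reverse all arrows incident to $k$; remove a maximal collection of oriented 2-cycles. A composite $\mu_b\mu_a$ means mutate first at $a$, then $b$. The framed quiver $\hat{Q}$ is obtained by adding a frozen vertex $k'$ and an arrow $k \to k'$ for each vertex $k$; frozen vertices are never mutated. A non-frozen vertex is green if no arrow goes from a frozen vertex into it, and red if no arrow goes from it into a frozen vertex. A maximal green sequence for $Q$ is a finite sequence of mutations of $\hat{Q}$ at non-frozen vertices, each performed at a vertex green at that moment, after which all non-frozen vertices are red; its length is the number of mutations. -}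

module Defs where

open import Data.Nat using (ℕ; zero; suc; _+_; _*_; _∸_; _≤_)
open import Data.Fin using (Fin; toℕ)
open import Data.Fin.Properties using (_≟_)
open import Data.Fin.Permutation using (Permutation′; _⟨$⟩ʳ_)
open import Data.Sum using (_⊎_; inj₁; inj₂)
open import Data.Sum.Properties using (≡-dec)
open import Data.Product using (_×_; Σ-syntax; ∃-syntax)
open import Data.List using (List; []; _∷_; length)
open import Data.List.Membership.Propositional using (_∈_)
open import Data.List.Relation.Unary.Unique.Propositional using (Unique)
open import Relation.Binary.PropositionalEquality using (_≡_)
open import Relation.Binary.Definitions using (DecidableEquality)
open import Relation.Nullary using (¬_; yes; no)
open import Function.Bundles using (_⇔_)

-- Quivers (without loops / oriented 2-cycles as intended) on a vertex
-- type V, given by arrow multiplicities: Q i j = number of arrows i → j.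

Quiver : Set → Set
Quiver V = V → V → ℕ

-- Mutation at k (Fomin–Zelevinsky quiver mutation):
--  * for every path h → k → l add an arrow h → l
--    (h , l ≠ k: Q h l + Q h k * Q k l arrows h → l),
--  * reverse all arrows incident to k,
--  * remove a maximal collection of oriented 2-cycles
--    (keep  a ∸ b  arrows h → l where a, b are the counts h → l, l → h).
mutate : {V : Set} → DecidableEquality V → V → Quiver V → Quiver V
mutate _≟V_ k Q i j with i ≟V k | j ≟V k
... | yes _ | _     = Q j i
... | no _  | yes _ = Q j i
... | no _  | no _  = (Q i j + Q i k * Q k j) ∸ (Q j i + Q j k * Q k i)

-- Framed quivers: vertices inj₁ i (mutable) and inj₂ i = i' (frozen).

FVertex : ℕ → Set
FVertex n = Fin n ⊎ Fin n

_≟F_ : {n : ℕ} → DecidableEquality (FVertex n)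
_≟F_ = ≡-dec _≟_ _≟_

framed : {n : ℕ} → Quiver (Fin n) → Quiver (FVertex n)
framed Q (inj₁ i) (inj₁ j) = Q i j
framed Q (inj₁ i) (inj₂ j) with i ≟ j
... | yes _ = 1
... | no _  = 0
framed Q (inj₂ _) _ = 0

fmutate : {n : ℕ} → Fin n → Quiver (FVertex n) → Quiver (FVertex n)
fmutate k = mutate _≟F_ (inj₁ k)

mutateSeq : {n : ℕ} → List (Fin n) → Quiver (FVertex n) → Quiver (FVertex n)
mutateSeq []       R = R
mutateSeq (k ∷ ks) R = mutateSeq ks (fmutate k R)

Green : {n : ℕ} → Quiver (FVertex n) → Fin n → Set
Green R k = ∀ f → R (inj₂ f) (inj₁ k) ≡ 0

Red : {n : ℕ} → Quiver (FVertex n) → Fin n → Set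
Red R k = ∀ f → R (inj₁ k) (inj₂ f) ≡ 0

GreenThenAllRed : {n : ℕ} → Quiver (FVertex n) → List (Fin n) → Set
GreenThenAllRed R []       = ∀ k → Red R k
GreenThenAllRed R (k ∷ ks) = Green R k × GreenThenAllRed (fmutate k R) ks

IsMaximalGreenSequence : {n : ℕ} → Quiver (Fin n) → List (Fin n) → Set
IsMaximalGreenSequence Q s = GreenThenAllRed (framed Q) s

IsMinimalLengthMGS : {n : ℕ} → Quiver (Fin n) → List (Fin n) → Set
IsMinimalLengthMGS Q s =
  IsMaximalGreenSequence Q s ×
  (∀ s' → IsMaximalGreenSequence Q s' → length s ≤ length s')

IsSource : {n : ℕ} → Quiver (Fin n) → Fin n → Set
IsSource Q v = ∀ u → Q u v ≡ 0

IsSink : {n : ℕ} → Quiver (Fin n) → Fin n → Set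
IsSink Q v = ∀ u → Q v u ≡ 0

Adjacent : {n : ℕ} → Fin n → Fin n → Set
Adjacent i j = (suc (toℕ i) ≡ toℕ j) ⊎ (suc (toℕ j) ≡ toℕ i)

UnderlyingPath : {n : ℕ} → Quiver (Fin n) → Set
UnderlyingPath {n} Q = Σ[ σ ∈ Permutation′ n ]
  ((∀ i j → Adjacent i j → Q (σ ⟨$⟩ʳ i) (σ ⟨$⟩ʳ j) + Q (σ ⟨$⟩ʳ j) (σ ⟨$⟩ʳ i) ≡ 1) ×
   (∀ i j → ¬ Adjacent i j → Q (σ ⟨$⟩ʳ i) (σ ⟨$⟩ʳ j) + Q (σ ⟨$⟩ʳ j) (σ ⟨$⟩ʳ i) ≡ 0))

IsZigzag : {n : ℕ} → Quiver (Fin n) → Set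
IsZigzag Q = UnderlyingPath Q × (∀ v → IsSource Q v ⊎ IsSink Q v)

IsOrderingOf : {n : ℕ} → (Fin n → Set) → List (Fin n) → Set
IsOrderingOf P xs = Unique xs × (∀ v → (v ∈ xs) ⇔ P v)

-- Mutating at a vertex with no incoming arrows just reverses the arrows at it.
-- In the framed zigzag every source has only outgoing arrows, and sources are
-- pairwise non-adjacent, so mutating at them in any order reverses all arrows
-- at the sources: this turns the sources red and the sinks into sources (their
-- frozen arrows are untouched), so mutating next at the sinks turns every
-- vertex red, each mutation being at a green vertex. Conversely, as long as
-- the framing arrow j → j′ is present mutation at another green vertex cannot
-- remove it, so a maximal green sequence mutates every vertex at least once.
module Submission where

open import Defs
open import Data.Nat using (ℕ; suc; _≤_; _+_; _*_; _∸_; s≤s)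
open import Data.Nat.Properties using (≤-total; m≤n⇒m∸n≡0; m+n≡0⇒m≡0; +-identityʳ; 0∸n≡0)
open import Data.Fin using (Fin; zero; suc; inject₁)
open import Data.Fin.Properties using (_≟_; toℕ-inject₁; injective⇒≤)
open import Data.Fin.Permutation using (_⟨$⟩ʳ_; _⟨$⟩ˡ_; inverseʳ)
open import Data.Sum using (_⊎_; inj₁; inj₂; [_,_]; swap; map)
open import Data.Sum.Properties using (inj₁-injective)
open import Data.Product using (_,_; proj₁; proj₂; ∃-syntax)
open import Data.List using (List; []; _∷_; _++_; length; lookup)
open import Data.List.Properties using (++-identityʳ)
open import Data.List.Membership.Propositional using (_∈_; _∉_)
open import Data.List.Membership.Propositional.Properties using (∈-lookup)
open import Data.List.Relation.Unary.Any using (here; there; index; any?)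
open import Data.List.Relation.Unary.Any.Properties using (lookup-index)
import Data.List.Relation.Unary.All as All
open import Data.List.Relation.Unary.AllPairs using (_∷_)
open import Data.List.Relation.Unary.Unique.Propositional using (Unique)
open import Data.List.Relation.Unary.Unique.Propositional.Properties using (++⁺)
open import Data.Empty using (⊥; ⊥-elim)
open import Function using (_∘_)
open import Function.Bundles using (Equivalence)
open import Relation.Binary.Definitions using (DecidableEquality)
open import Relation.Binary.PropositionalEquality
  using (_≡_; _≢_; refl; sym; trans; cong; cong₂; subst; subst₂; module ≡-Reasoning)
open import Relation.Nullary using (¬_; Dec; yes; no)
open import Level using (0ℓ)
open import Relation.Unary using (Pred; Decidable)

private
  variable
    n : ℕ
    V : Set

_≐_ : Quiver V → Quiver V → Set
R ≐ R′ = ∀ a b → R a b ≡ R′ a b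

≐-sym : {R R′ : Quiver V} → R ≐ R′ → R′ ≐ R
≐-sym R≐R′ a b = sym (R≐R′ a b)

Source : Quiver V → V → Set
Source R a = ∀ x → R x a ≡ 0

Sink : Quiver V → V → Set
Sink R a = ∀ x → R a x ≡ 0

-- With a = b this also excludes loops.
NoTwoCycles : Quiver V → Set
NoTwoCycles R = ∀ a b → R a b ≡ 0 ⊎ R b a ≡ 0

sourceOrSink⇒NoTwoCycles : {R : Quiver V} → (∀ a → Source R a ⊎ Sink R a) → NoTwoCycles R
sourceOrSink⇒NoTwoCycles sourceOrSink a b =
  [ (λ source → inj₂ (source b)) , (λ sink → inj₁ (sink b)) ] (sourceOrSink a)

x+y∸u+v*w≡0⇒x≡0 : ∀ {x y u v w} → u ≡ 0 → v ≡ 0 → (x + y) ∸ (u + v * w) ≡ 0 → x ≡ 0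
x+y∸u+v*w≡0⇒x≡0 {x} refl refl = m+n≡0⇒m≡0 x

x+u*w∸y+v*z≡x : ∀ {x y u v w z} → u ≡ 0 → v ≡ 0 → x ≡ 0 ⊎ y ≡ 0 → (x + u * w) ∸ (y + v * z) ≡ x
x+u*w∸y+v*z≡x {y = y} refl refl (inj₁ refl) = 0∸n≡0 (y + 0)
x+u*w∸y+v*z≡x {x}     refl refl (inj₂ refl) = +-identityʳ x

∸-zero⊎zero : ∀ x y → x ∸ y ≡ 0 ⊎ y ∸ x ≡ 0
∸-zero⊎zero x y with ≤-total x y
... | inj₁ x≤y = inj₁ (m≤n⇒m∸n≡0 x≤y)
... | inj₂ y≤x = inj₂ (m≤n⇒m∸n≡0 y≤x)

module _ {P : Pred V 0ℓ} (P? : Decidable P) where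

  reverseOn : Quiver V → Quiver V
  reverseOn R a b with P? a | P? b
  ... | yes _ | _     = R b a
  ... | no _  | yes _ = R b a
  ... | no _  | no _  = R a b

  reverseOn-touching : ∀ {R a b} → P a ⊎ P b → reverseOn R a b ≡ R b a
  reverseOn-touching {a = a} {b} touching with P? a | P? b
  ... | yes _ | _     = refl
  ... | no _  | yes _ = refl
  ... | no ¬a | no ¬b = ⊥-elim ([ ¬a , ¬b ] touching)

  reverseOn-avoiding : ∀ {R a b} → ¬ P a → ¬ P b → reverseOn R a b ≡ R a b
  reverseOn-avoiding {a = a} {b} ¬a ¬b with P? a | P? b
  ... | yes pa | _     = ⊥-elim (¬a pa)
  ... | no _   | yes pb = ⊥-elim (¬b pb)
  ... | no _   | no _   = refl

  touching? : ∀ a b → Dec (P a ⊎ P b)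
  touching? a b with P? a | P? b
  ... | yes pa | _      = yes (inj₁ pa)
  ... | no _   | yes pb = yes (inj₂ pb)
  ... | no ¬a  | no ¬b  = no [ ¬a , ¬b ]

  reverseOn-NoTwoCycles : ∀ {R} → NoTwoCycles R → NoTwoCycles (reverseOn R)
  reverseOn-NoTwoCycles noCycles a b with touching? a b
  ... | yes t = subst₂ (λ x y → x ≡ 0 ⊎ y ≡ 0)
    (sym (reverseOn-touching t)) (sym (reverseOn-touching (swap t))) (swap (noCycles a b))
  ... | no ¬t = subst₂ (λ x y → x ≡ 0 ⊎ y ≡ 0)
    (sym (reverseOn-avoiding (¬t ∘ inj₁) (¬t ∘ inj₂)))
    (sym (reverseOn-avoiding (¬t ∘ inj₂) (¬t ∘ inj₁))) (noCycles a b)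

  reverseOn-Source : ∀ {R a} → ¬ P a → (∀ {x} → P x → R a x ≡ 0) → (∀ {x} → ¬ P x → R x a ≡ 0) →
    Source (reverseOn R) a
  reverseOn-Source {a = a} ¬a out-of-a into-a x with touching? x a
  ... | yes (inj₁ px) = trans (reverseOn-touching (inj₁ px)) (out-of-a px)
  ... | yes (inj₂ pa) = ⊥-elim (¬a pa)
  ... | no ¬t         = trans (reverseOn-avoiding (¬t ∘ inj₁) ¬a) (into-a (¬t ∘ inj₁))

reverseOn-∘ : {P₁ P₂ P : Pred V 0ℓ} (P₁? : Decidable P₁) (P₂? : Decidable P₂) (P? : Decidable P) →
  (∀ {a} → P₁ a → P a) → (∀ {a} → P₂ a → P a) → (∀ {a} → P a → P₁ a ⊎ P₂ a) →
  (∀ {a} → P₁ a → ¬ P₂ a) →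
  ∀ {R} → (∀ {a b} → P₁ a → P₂ b → R a b ≡ R b a) →
  reverseOn P₂? (reverseOn P₁? R) ≐ reverseOn P? R
reverseOn-∘ {P₁ = P₁} {P₂} P₁? P₂? P? P₁⊆P P₂⊆P P⊆P₁∪P₂ disjoint {R} balanced a b
  with touching? P₁? a b | touching? P₂? a b
... | yes t₁ | yes t₂ = begin
  reverseOn P₂? (reverseOn P₁? R) a b ≡⟨ reverseOn-touching P₂? t₂ ⟩
  reverseOn P₁? R b a                 ≡⟨ reverseOn-touching P₁? (swap t₁) ⟩
  R a b                               ≡⟨ crossing t₁ t₂ ⟩
  R b a                               ≡⟨ reverseOn-touching P? (map P₁⊆P P₁⊆P t₁) ⟨
  reverseOn P? R a b                  ∎
  where
  open ≡-Reasoning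
  crossing : P₁ a ⊎ P₁ b → P₂ a ⊎ P₂ b → R a b ≡ R b a
  crossing (inj₁ p₁) (inj₁ p₂) = ⊥-elim (disjoint p₁ p₂)
  crossing (inj₁ p₁) (inj₂ p₂) = balanced p₁ p₂
  crossing (inj₂ p₁) (inj₁ p₂) = sym (balanced p₁ p₂)
  crossing (inj₂ p₁) (inj₂ p₂) = ⊥-elim (disjoint p₁ p₂)
... | no ¬t₁ | yes t₂ = trans (reverseOn-touching P₂? t₂)
  (trans (reverseOn-avoiding P₁? (¬t₁ ∘ inj₂) (¬t₁ ∘ inj₁))
    (sym (reverseOn-touching P? (map P₂⊆P P₂⊆P t₂))))
... | yes t₁ | no ¬t₂ = trans (reverseOn-avoiding P₂? (¬t₂ ∘ inj₁) (¬t₂ ∘ inj₂))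
  (trans (reverseOn-touching P₁? t₁) (sym (reverseOn-touching P? (map P₁⊆P P₁⊆P t₁))))
... | no ¬t₁ | no ¬t₂ = trans (reverseOn-avoiding P₂? (¬t₂ ∘ inj₁) (¬t₂ ∘ inj₂))
  (trans (reverseOn-avoiding P₁? (¬t₁ ∘ inj₁) (¬t₁ ∘ inj₂))
    (sym (reverseOn-avoiding P? ([ ¬t₁ ∘ inj₁ , ¬t₂ ∘ inj₁ ] ∘ P⊆P₁∪P₂)
                                ([ ¬t₁ ∘ inj₂ , ¬t₂ ∘ inj₂ ] ∘ P⊆P₁∪P₂))))

module _ (_≟V_ : DecidableEquality V) where

  mutate-cong : ∀ k {R R′ : Quiver V} → R ≐ R′ → mutate _≟V_ k R ≐ mutate _≟V_ k R′
  mutate-cong k R≐R′ a b with a ≟V k | b ≟V k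
  ... | yes _ | _     = R≐R′ b a
  ... | no _  | yes _ = R≐R′ b a
  ... | no _  | no _  = cong₂ _∸_
    (cong₂ _+_ (R≐R′ a b) (cong₂ _*_ (R≐R′ a k) (R≐R′ k b)))
    (cong₂ _+_ (R≐R′ b a) (cong₂ _*_ (R≐R′ b k) (R≐R′ k a)))

  mutate-NoTwoCycles : ∀ k {R : Quiver V} → NoTwoCycles R → NoTwoCycles (mutate _≟V_ k R)
  mutate-NoTwoCycles k {R} noCycles a b with a ≟V k | b ≟V k
  ... | yes _ | yes _ = swap (noCycles a b)
  ... | yes _ | no _  = swap (noCycles a b)
  ... | no _  | yes _ = swap (noCycles a b)
  ... | no _  | no _  = ∸-zero⊎zero (R a b + R a k * R k b) (R b a + R b k * R k a)

  -- Without arrows b → k, only old arrows b → a can cancel the arrows a → b,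
  -- and there are none of those if a → b is present.
  mutate-≡0⇒≡0 : ∀ {k a b} {R : Quiver V} → NoTwoCycles R → a ≢ k → b ≢ k →
    R b k ≡ 0 → mutate _≟V_ k R a b ≡ 0 → R a b ≡ 0
  mutate-≡0⇒≡0 {k} {a} {b} noCycles a≢k b≢k bk≡0 mutated≡0
    with a ≟V k | b ≟V k | noCycles a b
  ... | yes a≡k | _       | _        = ⊥-elim (a≢k a≡k)
  ... | no _    | yes b≡k | _        = ⊥-elim (b≢k b≡k)
  ... | no _    | no _    | inj₁ ab≡0 = ab≡0
  ... | no _    | no _    | inj₂ ba≡0 = x+y∸u+v*w≡0⇒x≡0 ba≡0 bk≡0 mutated≡0

  mutate-at-Source : ∀ {k} {R : Quiver V} → NoTwoCycles R → Source R k →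
    mutate _≟V_ k R ≐ reverseOn (_≟V k) R
  mutate-at-Source {k} noCycles source a b with a ≟V k | b ≟V k
  ... | yes _ | _     = refl
  ... | no _  | yes _ = refl
  ... | no _  | no _  = x+u*w∸y+v*z≡x (source a) (source b) (noCycles a b)

GreenThenAllRed-cong : ∀ {R R′ : Quiver (FVertex n)} s → R ≐ R′ →
  GreenThenAllRed R s → GreenThenAllRed R′ s
GreenThenAllRed-cong []      R≐R′ allRed k f      = trans (sym (R≐R′ _ _)) (allRed k f)
GreenThenAllRed-cong (k ∷ s) R≐R′ (green , rest) =
  (λ f → trans (sym (R≐R′ _ _)) (green f)) ,
  GreenThenAllRed-cong s (mutate-cong _≟F_ (inj₁ k) R≐R′) rest

framed-NoTwoCycles : {Q : Quiver (Fin n)} → NoTwoCycles Q → NoTwoCycles (framed Q)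
framed-NoTwoCycles noCycles (inj₁ i) (inj₁ j) = noCycles i j
framed-NoTwoCycles noCycles (inj₁ i) (inj₂ j) = inj₂ refl
framed-NoTwoCycles noCycles (inj₂ i) b        = inj₁ refl

framed-Source : {Q : Quiver (Fin n)} → ∀ {v} → Source Q v → Source (framed Q) (inj₁ v)
framed-Source source (inj₁ u) = source u
framed-Source source (inj₂ u) = refl

framed-¬Red : (Q : Quiver (Fin n)) → ∀ j → ¬ Red (framed Q) j
framed-¬Red Q j red with j ≟ j | red j
... | yes _   | ()
... | no j≢j | _  = j≢j refl

Red-before-mutation : ∀ {R : Quiver (FVertex n)} {k j} → NoTwoCycles R → Green R k → j ≢ k →
  Red (fmutate k R) j → Red R j
Red-before-mutation noCycles green j≢k red f =
  mutate-≡0⇒≡0 _≟F_ noCycles (j≢k ∘ inj₁-injective) (λ ()) (green f) (red f)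

¬Red⇒mutated : ∀ {R : Quiver (FVertex n)} s {j} → NoTwoCycles R → GreenThenAllRed R s →
  ¬ Red R j → j ∈ s
¬Red⇒mutated []      _            allRed         ¬red = ⊥-elim (¬red (allRed _))
¬Red⇒mutated (k ∷ s) {j} noCycles (green , rest) ¬red with j ≟ k
... | yes j≡k = here j≡k
... | no j≢k  = there (¬Red⇒mutated s (mutate-NoTwoCycles _≟F_ (inj₁ k) noCycles) rest
                         (¬red ∘ Red-before-mutation noCycles green j≢k))

Unique⇒lookup-injective : ∀ {A : Set} {xs : List A} → Unique xs →
  ∀ i j → lookup xs i ≡ lookup xs j → i ≡ j
Unique⇒lookup-injective (_ ∷ _)      zero    zero    _  = refl
Unique⇒lookup-injective (x∉ ∷ _)     zero    (suc j) eq = ⊥-elim (All.lookup x∉ (∈-lookup j) eq)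
Unique⇒lookup-injective (x∉ ∷ _)     (suc i) zero    eq = ⊥-elim (All.lookup x∉ (∈-lookup i) (sym eq))
Unique⇒lookup-injective (_ ∷ unique) (suc i) (suc j) eq =
  cong suc (Unique⇒lookup-injective unique i j eq)

Unique-⊆⇒length-≤ : ∀ {A : Set} {xs ys : List A} → Unique xs → (∀ {x} → x ∈ xs → x ∈ ys) →
  length xs ≤ length ys
Unique-⊆⇒length-≤ {xs = xs} {ys} unique xs⊆ys = injective⇒≤ {f = position} position-injective
  where
  position : Fin (length xs) → Fin (length ys)
  position i = index (xs⊆ys (∈-lookup i))
  position-injective : ∀ {i j} → position i ≡ position j → i ≡ j
  position-injective {i} {j} eq = Unique⇒lookup-injective unique i j (begin
    lookup xs i                  ≡⟨ lookup-index (xs⊆ys (∈-lookup i)) ⟩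
    lookup ys (position i)       ≡⟨ cong (lookup ys) eq ⟩
    lookup ys (position j)       ≡⟨ lookup-index (xs⊆ys (∈-lookup j)) ⟨
    lookup xs j                  ∎)
    where open ≡-Reasoning

Unique⇒length-≤-MaximalGreen : ∀ {Q : Quiver (Fin n)} {xs s} → NoTwoCycles Q → Unique xs →
  IsMaximalGreenSequence Q s → length xs ≤ length s
Unique⇒length-≤-MaximalGreen {Q = Q} {s = s} noCycles unique maximalGreen =
  Unique-⊆⇒length-≤ unique (λ _ →
    ¬Red⇒mutated s (framed-NoTwoCycles noCycles) maximalGreen (framed-¬Red Q _))

_∈ᶠ_ : FVertex n → List (Fin n) → Set
inj₁ v ∈ᶠ xs = v ∈ xs
inj₂ _ ∈ᶠ xs = ⊥

_∈ᶠ?_ : ∀ a (xs : List (Fin n)) → Dec (a ∈ᶠ xs)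
inj₁ v ∈ᶠ? xs = any? (v ≟_) xs
inj₂ _ ∈ᶠ? xs = no λ ()

reverseAt : List (Fin n) → Quiver (FVertex n) → Quiver (FVertex n)
reverseAt xs = reverseOn (_∈ᶠ? xs)

reverseAt-[] : ∀ {R : Quiver (FVertex n)} → reverseAt [] R ≐ R
reverseAt-[] a b = reverseOn-avoiding (_∈ᶠ? []) (∉ᶠ[] a) (∉ᶠ[] b)
  where
  ∉ᶠ[] : ∀ (a : FVertex n) → ¬ a ∈ᶠ []
  ∉ᶠ[] (inj₁ _) ()
  ∉ᶠ[] (inj₂ _) ()

reverseAt-∷ : ∀ {R : Quiver (FVertex n)} {k xs} → k ∉ xs → Source R (inj₁ k) →
  (∀ {x} → x ∈ xs → Source R (inj₁ x)) →
  reverseAt xs (reverseOn (_≟F inj₁ k) R) ≐ reverseAt (k ∷ xs) R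
reverseAt-∷ {R = R} {k} {xs} k∉xs source sources =
  reverseOn-∘ (_≟F inj₁ k) (_∈ᶠ? xs) (_∈ᶠ? (k ∷ xs)) k∈ᶠ ∈ᶠ-there ∈ᶠ-∷⁻ k∉ᶠ balanced
  where
  k∈ᶠ : ∀ {a} → a ≡ inj₁ k → a ∈ᶠ (k ∷ xs)
  k∈ᶠ refl = here refl
  ∈ᶠ-there : ∀ {a} → a ∈ᶠ xs → a ∈ᶠ (k ∷ xs)
  ∈ᶠ-there {inj₁ _} = there
  ∈ᶠ-∷⁻ : ∀ {a} → a ∈ᶠ (k ∷ xs) → a ≡ inj₁ k ⊎ a ∈ᶠ xs
  ∈ᶠ-∷⁻ {inj₁ _} (here v≡k) = inj₁ (cong inj₁ v≡k)
  ∈ᶠ-∷⁻ {inj₁ _} (there v∈xs) = inj₂ v∈xs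
  k∉ᶠ : ∀ {a} → a ≡ inj₁ k → ¬ a ∈ᶠ xs
  k∉ᶠ refl = k∉xs
  balanced : ∀ {a b} → a ≡ inj₁ k → b ∈ᶠ xs → R a b ≡ R b a
  balanced {b = inj₁ _} refl x∈xs = trans (sources x∈xs _) (sym (source _))

mutateSources : ∀ {R : Quiver (FVertex n)} xs {rest} → NoTwoCycles R → Unique xs →
  (∀ {x} → x ∈ xs → Source R (inj₁ x)) →
  GreenThenAllRed (reverseAt xs R) rest → GreenThenAllRed R (xs ++ rest)
mutateSources [] {rest} _ _ _ = GreenThenAllRed-cong rest reverseAt-[]
mutateSources {R = R} (k ∷ xs) {rest} noCycles (k≢xs ∷ unique) sources reversed =
  (λ f → source (inj₂ f)) ,
  GreenThenAllRed-cong (xs ++ rest) (≐-sym (mutate-at-Source _≟F_ noCycles source))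
    (mutateSources xs (reverseOn-NoTwoCycles (_≟F inj₁ k) noCycles) unique sources′
      (GreenThenAllRed-cong rest (≐-sym (reverseAt-∷ k∉xs source (sources ∘ there))) reversed))
  where
  source : Source R (inj₁ k)
  source = sources (here refl)
  k∉xs : k ∉ xs
  k∉xs k∈xs = All.lookup k≢xs k∈xs refl
  sources′ : ∀ {x} → x ∈ xs → Source (reverseOn (_≟F inj₁ k) R) (inj₁ x)
  sources′ x∈xs = reverseOn-Source (_≟F inj₁ k)
    (λ x≡k → All.lookup k≢xs x∈xs (sym (inj₁-injective x≡k)))
    (λ { refl → source _ })
    (λ _ → sources (there x∈xs) _)

Adjacent-exists : ∀ {m} (i : Fin (suc (suc m))) → ∃[ j ] Adjacent i j
Adjacent-exists zero    = suc zero , inj₁ refl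
Adjacent-exists (suc i) = inject₁ i , inj₂ (cong suc (toℕ-inject₁ i))

UnderlyingPath⇒¬Source×Sink : ∀ {m} {Q : Quiver (Fin (suc (suc m)))} → UnderlyingPath Q →
  ∀ v → Source Q v → ¬ Sink Q v
UnderlyingPath⇒¬Source×Sink {Q = Q} (σ , adjacent , _) v source sink
  with Adjacent-exists (σ ⟨$⟩ˡ v)
... | j , i~j = 0≢1 (subst₂ (λ x y → x + y ≡ 1) (sink w) (source w) v~w)
  where
  w : Fin (suc (suc _))
  w = σ ⟨$⟩ʳ j
  v~w : Q v w + Q w v ≡ 1
  v~w = subst (λ u → Q u w + Q w u ≡ 1) (inverseʳ σ) (adjacent _ j i~j)
  0≢1 : ¬ 0 ≡ 1
  0≢1 ()

module Zigzag {Q : Quiver (Fin n)}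
  (sourceOrSink : ∀ v → Source Q v ⊎ Sink Q v) (¬Source×Sink : ∀ v → Source Q v → ¬ Sink Q v)
  {cs ks} (cs-sources : IsOrderingOf (IsSource Q) cs) (ks-sinks : IsOrderingOf (IsSink Q) ks)
  where

  open Equivalence

  Q-noCycles : NoTwoCycles Q
  Q-noCycles = sourceOrSink⇒NoTwoCycles sourceOrSink

  noCycles : NoTwoCycles (framed Q)
  noCycles = framed-NoTwoCycles Q-noCycles

  afterSources : Quiver (FVertex n)
  afterSources = reverseAt cs (framed Q)

  sink⇒∉cs : ∀ {k} → Sink Q k → k ∉ cs
  sink⇒∉cs {k} sink k∈cs = ¬Source×Sink k (to (proj₂ cs-sources k) k∈cs) sink

  -- The arrows into a sink k come from sources and get reversed, while k → k′ stays.
  sinks-Source : ∀ {k} → k ∈ ks → Source afterSources (inj₁ k)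
  sinks-Source {k} k∈ks = reverseOn-Source (_∈ᶠ? cs) (sink⇒∉cs sink) out-of-k into-k
    where
    sink : Sink Q k
    sink = to (proj₂ ks-sinks k) k∈ks
    out-of-k : ∀ {x} → x ∈ᶠ cs → framed Q (inj₁ k) x ≡ 0
    out-of-k {inj₁ c} _ = sink c
    into-k : ∀ {x} → ¬ x ∈ᶠ cs → framed Q x (inj₁ k) ≡ 0
    into-k {inj₁ u} u∉cs with sourceOrSink u
    ... | inj₁ source = ⊥-elim (u∉cs (from (proj₂ cs-sources u) source))
    ... | inj₂ sink′  = sink′ k
    into-k {inj₂ _} _ = refl

  allRed : ∀ i → Red (reverseAt ks afterSources) i
  allRed i f with sourceOrSink i
  ... | inj₁ source = trans
    (reverseOn-avoiding (_∈ᶠ? ks) (¬Source×Sink i source ∘ to (proj₂ ks-sinks i)) λ ())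
    (reverseOn-touching (_∈ᶠ? cs) (inj₁ (from (proj₂ cs-sources i) source)))
  ... | inj₂ sink = trans
    (reverseOn-touching (_∈ᶠ? ks) (inj₁ (from (proj₂ ks-sinks i) sink)))
    (sinks-Source (from (proj₂ ks-sinks i) sink) (inj₂ f))

  maximalGreen : IsMaximalGreenSequence Q (cs ++ ks)
  maximalGreen = mutateSources cs noCycles (proj₁ cs-sources)
    (λ {c} c∈cs → framed-Source (to (proj₂ cs-sources c) c∈cs))
    (subst (GreenThenAllRed afterSources) (++-identityʳ ks)
      (mutateSources ks (reverseOn-NoTwoCycles (_∈ᶠ? cs) noCycles) (proj₁ ks-sinks)
        sinks-Source allRed))

  minimal : ∀ s → IsMaximalGreenSequence Q s → length (cs ++ ks) ≤ length s
  minimal s = Unique⇒length-≤-MaximalGreen Q-noCycles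
    (++⁺ (proj₁ cs-sources) (proj₁ ks-sinks)
      λ (v∈cs , v∈ks) → sink⇒∉cs (to (proj₂ ks-sinks _) v∈ks) v∈cs)

proposition4p5 : (n : ℕ) → 3 ≤ n → (Q : Quiver (Fin n)) → IsZigzag Q →
    (cs ks : List (Fin n)) → IsOrderingOf (IsSource Q) cs → IsOrderingOf (IsSink Q) ks →
    IsMinimalLengthMGS Q (cs ++ ks)
proposition4p5 _ (s≤s (s≤s _)) Q (path , sourceOrSink) cs ks cs-sources ks-sinks =
  maximalGreen , minimal
  where open Zigzag sourceOrSink (UnderlyingPath⇒¬Source×Sink path) cs-sources ks-sinks
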